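{- Let $X=[n]$ be the disjoint union of sets $X_1,\dots,X_r$ ($r\ge1$), and let $F_1,\dots,F_m\subseteq[n]$ be such that the family $\mathcal{F}=\{F_1,\dots,F_m\}$ is an anti-chain. Then $$\sum_{i=1}^m \left(\prod_{k=1}^r \binom{|X_k|}{|F_i\cap X_k|}\right)^{ -1} \le \left(1+\frac{n}{r}\right)^{r-1}.$$
   Context: A family $\mathcal{F}$ of sets is an anti-chain if $A\not\subseteq B$ for any two distinct $A,B\in\mathcal{F}$. Here $[n]=\{1,\dots,n\}$. -}

module Defs where

open import Data.Nat using (ℕ; zero; suc)
import Data.Nat as ℕ
open import Data.Nat.Combinatorics using (_C_)
open import Data.Fin using (Fin; zero; suc)
open import Data.Fin.Subset using (Subset; _∩_; ∣_∣)
open import Data.Vec using (tabulate)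
open import Data.Bool using (Bool)
open import Relation.Nullary.Decidable using (⌊_⌋)
open import Data.Fin using (_≟_)
open import Data.Integer using (+_)
open import Data.Rational using (ℚ; 0ℚ; 1ℚ; _+_; _*_; _/_)

sumℚ : ∀ {m} → (Fin m → ℚ) → ℚ
sumℚ {zero}  f = 0ℚ
sumℚ {suc m} f = f zero + sumℚ (λ i → f (suc i))

prodℕ : ∀ {r} → (Fin r → ℕ) → ℕ
prodℕ {zero}  f = 1
prodℕ {suc r} f = f zero ℕ.* prodℕ (λ i → f (suc i))

_^ℚ_ : ℚ → ℕ → ℚ
q ^ℚ zero  = 1ℚ
q ^ℚ suc k = q * (q ^ℚ k)

-- Reciprocal 1/k of a natural number as a rational (only ever applied to
-- positive arguments here; the value at 0 is an irrelevant convention).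
recipℕ : ℕ → ℚ
recipℕ zero    = 0ℚ
recipℕ (suc k) = + 1 / suc k

-- The block X_k = { x ∈ [n] | c x = k } of the partition given by c : [n] → [r].
block : ∀ {n r} → (Fin n → Fin r) → Fin r → Subset n
block c k = tabulate (λ x → ⌊ c x ≟ k ⌋)

weight : ∀ {n r} → (Fin n → Fin r) → Subset n → ℕ
weight {r = r} c F = prodℕ {r} (λ k → ∣ block c k ∣ C ∣ F ∩ block c k ∣)

-- Let Xⱼ be a largest block. Multiplying through by N = ∏ₖ ∣Xₖ∣!, the term of F becomes its coweight
-- ∏ₖ f!(∣Xₖ∣ - f)! with f = ∣F ∩ Xₖ∣. Group the members of the antichain by their part outside Xⱼ: in each
-- group the parts inside Xⱼ form an antichain of Xⱼ, so by the LYM inequality the group contributes at most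
-- ∣Xⱼ∣! times the coweight of the common outer part, and summing that over all subsets of [n] ∖ Xⱼ gives
-- ∏_{k≠j} (∣Xₖ∣+1)!. Hence ∑ 1/weight ≤ ∏_{k≠j} (∣Xₖ∣+1), which AM–GM bounds by
-- ((n - ∣Xⱼ∣ + r - 1)/(r - 1))^(r-1), and this is at most (1 + n/r)^(r-1) since ∣Xⱼ∣ ≥ n/r.
module Submission where

open import Defs
open import Data.Fin using (Fin)
open import Data.Fin.Subset using (Subset; _⊆_)

-- The natural-number operators are opened only inside this anonymous module, so that the theorem at the end
-- can be stated with the rational ones.
module _ where
  open import Data.Bool using (Bool; true; false; not; _∧_)
  import Data.Bool as Bool
  open import Data.Bool.Properties using (∧-conicalˡ; ∧-conicalʳ; not-injective)
  open import Data.Empty using (⊥-elim)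
  open import Data.Fin using (zero; suc; punchIn; _≟_)
  open import Data.Fin.Properties using (any?; punchInᵢ≢i)
  open import Data.Fin.Subset using (_∈_; _∉_; _⊈_; _∩_; _-_; ∁; ⊤; ⊥; ⁅_⁆; ∣_∣; inside; outside)
  open import Data.Fin.Subset.Properties
    using (_∈?_; _⊆?_; drop-∷-⊆; out⊆; in⊆in; ⊆-refl; ⊆-antisym; ⊆-trans; p∩q⊆q; p⊆q⇒∣p∣≤∣q∣; ∣p∩q∣≤∣q∣;
           ∣⊥∣≡0; ∣⁅x⁆∣≡1; ∩-assoc; ∩-identityˡ; ∩-inverseˡ; ∩-zeroʳ; x∈p⇒∣p-x∣<∣p∣; x∈p∩q⁺; x∈p∩q⁻;
           x∉p⇒x∈∁p; x∈⁅y⁆⇒x≡y)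
  import Data.Integer as ℤ
  open import Data.Integer.Properties using (pos-+; pos-*)
  open import Data.Nat
    using (ℕ; zero; suc; pred; _+_; _*_; _∸_; _^_; _!; _≤_; _<_; z≤n; s≤s; NonZero)
  open import Data.Nat.Combinatorics using (_C_; nCk≡n!/k![n-k]!; k![n∸k]!∣n!)
  open import Data.Nat.DivMod using (m/n*n≡m)
  open import Data.Nat.Properties
    using (+-*-semiring; *-1-commutativeMonoid; *-commutativeSemigroup; +-commutativeSemigroup;
           module ≤-Reasoning;
           _≤?_; ≤-refl; ≤-reflexive; ≤-trans; ≤-pred; <⇒≤; ≰⇒>; n≮0; suc-injective; suc-pred;
           +-assoc; +-comm; +-identityʳ; +-suc; +-mono-≤; +-monoʳ-≤; m≤m+n; m≤n+m; m≤n⇒m≤1+n;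
           *-assoc; *-comm; *-identityˡ; *-identityʳ; *-zeroʳ; *-distribˡ-+; *-distribʳ-+;
           *-monoˡ-≤; *-monoʳ-≤; *-cancelˡ-≤; ^-monoˡ-≤;
           +-∸-assoc; m+[n∸m]≡n; m+n∸n≡m; m∸n+n≡m; n∸n≡0; m*n≢0; m^n≢0; _!≢0; _!*_!≢0)
  open import Data.Nat.Tactic.RingSolver using (solve-∀)
  open import Data.Product using (Σ-syntax; _×_; _,_; proj₁)
  open import Data.Rational as ℚ using (ℚ; 1ℚ; toℚᵘ)
  open import Data.Rational.Properties using (toℚᵘ-homo-+; toℚᵘ-homo-*; toℚᵘ-fromℚᵘ; toℚᵘ-cancel-≤)
  open import Data.Rational.Unnormalised using (ℚᵘ; mkℚᵘ; *≤*; *≡*)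
    renaming (_≤_ to _≤ᵘ_; _≃_ to _≃ᵘ_; _+_ to _+ᵘ_; _*_ to _*ᵘ_)
  open import Data.Rational.Unnormalised.Properties
    using (≃-refl; ≃-reflexive; ≃-sym; ≃-trans; ≤-respˡ-≃; ≤-respʳ-≃)
    renaming (+-cong to +ᵘ-cong; *-cong to *ᵘ-cong)
  open import Data.Vec using ([]; _∷_; lookup; here)
  open import Data.Vec.Functional using (removeAt)
  open import Data.Vec.Properties
    using (lookup-zipWith; lookup-map; lookup∘tabulate; []=⇒lookup; lookup⇒[]=; ≡-dec)
  open import Function using (_∘_)
  open import Relation.Binary.Definitions using (DecidableEquality)
  open import Relation.Binary.PropositionalEquality
  open import Relation.Nullary using (yes; no; does; _×-dec_)
  open import Relation.Nullary.Decidable using (⌊_⌋)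

  open import Algebra.Properties.Semiring.Sum +-*-semiring
    using (sum; sum-syntax; sum-cong-≗; sum-remove; ∑-distrib-+; ∑-comm; *-distribˡ-sum; *-distribʳ-sum)
  import Algebra.Properties.CommutativeMonoid.Sum *-1-commutativeMonoid as Product
  open import Algebra.Properties.CommutativeSemigroup *-commutativeSemigroup
    using (x∙yz≈y∙xz; xy∙z≈x∙zy) renaming (interchange to *-interchange)
  open import Algebra.Properties.CommutativeSemigroup +-commutativeSemigroup
    using () renaming (interchange to +-interchange)

  𝟙 : Bool → ℕ
  𝟙 true  = 1
  𝟙 false = 0

  𝟙-∧ : ∀ a b → 𝟙 (a ∧ b) ≡ 𝟙 a * 𝟙 b
  𝟙-∧ false b = refl
  𝟙-∧ true  b = sym (+-identityʳ (𝟙 b))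

  ∑-mono-≤ : ∀ {m} {f g : Fin m → ℕ} → (∀ i → f i ≤ g i) → sum f ≤ sum g
  ∑-mono-≤ {zero}  f≤g = z≤n
  ∑-mono-≤ {suc m} f≤g = +-mono-≤ (f≤g zero) (∑-mono-≤ (f≤g ∘ suc))

  ∑-const : ∀ m (a : ℕ) → ∑[ i < m ] a ≡ m * a
  ∑-const zero    a = refl
  ∑-const (suc m) a = cong (a +_) (∑-const m a)

  ∑-zero : ∀ {m} {f : Fin m → ℕ} → (∀ i → f i ≡ 0) → sum f ≡ 0
  ∑-zero {m} f≡0 = trans (sum-cong-≗ f≡0) (trans (∑-const m 0) (*-zeroʳ m))

  ∑-single : ∀ {m} (f : Fin m → ℕ) (i : Fin m) → (∀ i' → i' ≢ i → f i' ≡ 0) → sum f ≡ f i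
  ∑-single {suc m} f i f≡0 = begin
    sum f                         ≡⟨ sum-remove f ⟩
    f i + sum (removeAt f i)      ≡⟨ cong (f i +_) (∑-zero λ i' → f≡0 _ (punchInᵢ≢i i i')) ⟩
    f i + 0                       ≡⟨ +-identityʳ (f i) ⟩
    f i                           ∎
    where open ≡-Reasoning

  ∏ : ∀ {r} → (Fin r → ℕ) → ℕ
  ∏ = Product.sum

  ∏-syntax : ∀ r → (Fin r → ℕ) → ℕ
  ∏-syntax _ = ∏

  syntax ∏-syntax r (λ k → e) = ∏[ k < r ] e

  prodℕ≡∏ : ∀ {r} (f : Fin r → ℕ) → prodℕ f ≡ ∏ f
  prodℕ≡∏ {zero}  f = refl
  prodℕ≡∏ {suc r} f = cong (f zero *_) (prodℕ≡∏ (f ∘ suc))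

  ∏-cong : ∀ {r} {f g : Fin r → ℕ} → (∀ k → f k ≡ g k) → ∏ f ≡ ∏ g
  ∏-cong = Product.sum-cong-≗

  ∏-distrib-* : ∀ {r} (f g : Fin r → ℕ) → ∏[ k < r ] (f k * g k) ≡ ∏ f * ∏ g
  ∏-distrib-* = Product.∑-distrib-+

  ∏-update : ∀ {r} (f g : Fin r → ℕ) (k₀ : Fin r) {t : ℕ} →
    (∀ k → k ≢ k₀ → f k ≡ g k) → f k₀ ≡ t * g k₀ → ∏ f ≡ t * ∏ g
  ∏-update {suc r} f g k₀ {t} f≡g f[k₀]≡t*g[k₀] = begin
    ∏ f                             ≡⟨ Product.sum-remove f ⟩
    f k₀ * ∏ (removeAt f k₀)        ≡⟨ cong₂ _*_ f[k₀]≡t*g[k₀] (∏-cong λ i → f≡g _ (punchInᵢ≢i k₀ i)) ⟩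
    t * g k₀ * ∏ (removeAt g k₀)    ≡⟨ *-assoc t _ _ ⟩
    t * (g k₀ * ∏ (removeAt g k₀))  ≡⟨ cong (t *_) (Product.sum-remove g) ⟨
    t * ∏ g                         ∎
    where open ≡-Reasoning

  ∏-update-≟ : ∀ {r} (h : Fin r → Bool → ℕ) (k₀ : Fin r) {t : ℕ} →
    h k₀ true ≡ t * h k₀ false → ∏[ k < r ] h k ⌊ k₀ ≟ k ⌋ ≡ t * ∏[ k < r ] h k false
  ∏-update-≟ h k₀ {t} h[k₀]≡t*h[k₀] = ∏-update _ _ k₀ {t} off at
    where
    off : ∀ k → k ≢ k₀ → h k ⌊ k₀ ≟ k ⌋ ≡ h k false
    off k k≢k₀ with k₀ ≟ k
    ... | yes k₀≡k = ⊥-elim (k≢k₀ (sym k₀≡k))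
    ... | no  _    = refl
    at : h k₀ ⌊ k₀ ≟ k₀ ⌋ ≡ t * h k₀ false
    at with k₀ ≟ k₀
    ... | yes _    = h[k₀]≡t*h[k₀]
    ... | no k₀≢k₀ = ⊥-elim (k₀≢k₀ refl)

  ∏-nonZero : ∀ {r} (f : Fin r → ℕ) → (∀ k → NonZero (f k)) → NonZero (∏ f)
  ∏-nonZero {zero}  f f≢0 = _
  ∏-nonZero {suc r} f f≢0 = m*n≢0 _ _ {{f≢0 zero}} {{∏-nonZero (f ∘ suc) (f≢0 ∘ suc)}}

  ∣∷∣ : ∀ {n} b (p : Subset n) → ∣ b ∷ p ∣ ≡ 𝟙 b + ∣ p ∣
  ∣∷∣ true  p = refl
  ∣∷∣ false p = refl

  ∣p∣≡∑𝟙 : ∀ {n} (p : Subset n) → ∣ p ∣ ≡ ∑[ x < n ] 𝟙 (lookup p x)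
  ∣p∣≡∑𝟙 []      = refl
  ∣p∣≡∑𝟙 (b ∷ p) = trans (∣∷∣ b p) (cong (𝟙 b +_) (∣p∣≡∑𝟙 p))

  lookup-∩∁ : ∀ {n} (p q : Subset n) x → lookup (p ∩ ∁ q) x ≡ lookup p x ∧ not (lookup q x)
  lookup-∩∁ p q x = trans (lookup-zipWith _∧_ x p (∁ q)) (cong (lookup p x ∧_) (lookup-map x not q))

  ∣p∩∁q∣+∣q∣≡∣p∣ : ∀ {n} {p q : Subset n} → q ⊆ p → ∣ p ∩ ∁ q ∣ + ∣ q ∣ ≡ ∣ p ∣
  ∣p∩∁q∣+∣q∣≡∣p∣ {p = []}          {[]}          q⊆p = refl
  ∣p∩∁q∣+∣q∣≡∣p∣ {p = outside ∷ p} {outside ∷ q} q⊆p = ∣p∩∁q∣+∣q∣≡∣p∣ (drop-∷-⊆ q⊆p)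
  ∣p∩∁q∣+∣q∣≡∣p∣ {p = inside ∷ p}  {outside ∷ q} q⊆p = cong suc (∣p∩∁q∣+∣q∣≡∣p∣ (drop-∷-⊆ q⊆p))
  ∣p∩∁q∣+∣q∣≡∣p∣ {p = inside ∷ p}  {inside ∷ q}  q⊆p =
    trans (+-suc _ _) (cong suc (∣p∩∁q∣+∣q∣≡∣p∣ (drop-∷-⊆ q⊆p)))
  ∣p∩∁q∣+∣q∣≡∣p∣ {p = outside ∷ p} {inside ∷ q}  q⊆p with () ← q⊆p here

  ∣∁p∩p∣≡0 : ∀ {n} (p : Subset n) → ∣ ∁ p ∩ p ∣ ≡ 0
  ∣∁p∩p∣≡0 {n} p = trans (cong ∣_∣ (∩-inverseˡ p)) (∣⊥∣≡0 n)

  ∣p∣≡0⇒x∉p : ∀ {n} {p : Subset n} {x} → ∣ p ∣ ≡ 0 → x ∉ p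
  ∣p∣≡0⇒x∉p {p = p} {x} ∣p∣≡0 x∈p = n≮0 (subst (∣ p - x ∣ <_) ∣p∣≡0 (x∈p⇒∣p-x∣<∣p∣ x∈p))

  ∣p∩∁⁅x⁆∣+1≡∣p∣ : ∀ {n} {p : Subset n} {x} → x ∈ p → suc ∣ p ∩ ∁ ⁅ x ⁆ ∣ ≡ ∣ p ∣
  ∣p∩∁⁅x⁆∣+1≡∣p∣ {p = p} {x} x∈p = begin
    suc ∣ p ∩ ∁ ⁅ x ⁆ ∣          ≡⟨ +-comm 1 _ ⟩
    ∣ p ∩ ∁ ⁅ x ⁆ ∣ + 1          ≡⟨ cong (∣ p ∩ ∁ ⁅ x ⁆ ∣ +_) (∣⁅x⁆∣≡1 x) ⟨
    ∣ p ∩ ∁ ⁅ x ⁆ ∣ + ∣ ⁅ x ⁆ ∣  ≡⟨ ∣p∩∁q∣+∣q∣≡∣p∣ (λ y∈⁅x⁆ → subst (_∈ p) (sym (x∈⁅y⁆⇒x≡y x y∈⁅x⁆)) x∈p) ⟩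
    ∣ p ∣                        ∎
    where open ≡-Reasoning

  ⊆∧⊈⇒∣∣< : ∀ {n} {p q : Subset n} → q ⊆ p → p ⊈ q → ∣ q ∣ < ∣ p ∣
  ⊆∧⊈⇒∣∣< {p = p} {q} q⊆p p⊈q with ∣ p ∩ ∁ q ∣ in ∣p∩∁q∣≡k | ∣p∩∁q∣+∣q∣≡∣p∣ q⊆p
  ... | suc k | k+1+∣q∣≡∣p∣ = subst (_ <_) k+1+∣q∣≡∣p∣ (s≤s (m≤n+m _ k))
  ... | zero  | _ = ⊥-elim (p⊈q p⊆q)
    where
    p⊆q : p ⊆ q
    p⊆q {x} x∈p with x ∈? q
    ... | yes x∈q = x∈q
    ... | no  x∉q = ⊥-elim (∣p∣≡0⇒x∉p ∣p∩∁q∣≡k (x∈p∩q⁺ (x∈p , x∉p⇒x∈∁p x∉q)))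

  not-lookup⇒∉ : ∀ {n} {p : Subset n} {x} → not (lookup p x) ≡ true → x ∉ p
  not-lookup⇒∉ ¬p[x] x∈p with () ← trans (sym (not-injective ¬p[x])) ([]=⇒lookup x∈p)

  ⊆-∩∁⁅x⁆ : ∀ {n} {p q : Subset n} {x} → q ⊆ p → x ∉ q → q ⊆ p ∩ ∁ ⁅ x ⁆
  ⊆-∩∁⁅x⁆ {q = q} q⊆p x∉q {y} y∈q =
    x∈p∩q⁺ (q⊆p y∈q , x∉p⇒x∈∁p λ y∈⁅x⁆ → x∉q (subst (_∈ q) (x∈⁅y⁆⇒x≡y _ y∈⁅x⁆) y∈q))

  ∩-monoˡ-⊆ : ∀ {n} {p q : Subset n} r → p ⊆ q → p ∩ r ⊆ q ∩ r
  ∩-monoˡ-⊆ r p⊆q x∈p∩r = let x∈p , x∈r = x∈p∩q⁻ _ r x∈p∩r in x∈p∩q⁺ (p⊆q x∈p , x∈r)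

  ⊆-by-parts : ∀ {n} {p p′ q : Subset n} → p ∩ ∁ q ≡ p′ ∩ ∁ q → p ∩ q ⊆ p′ ∩ q → p ⊆ p′
  ⊆-by-parts {q = q} outside≡ inside⊆ {x} x∈p with x ∈? q
  ... | yes x∈q = proj₁ (x∈p∩q⁻ _ _ (inside⊆ (x∈p∩q⁺ (x∈p , x∈q))))
  ... | no  x∉q = proj₁ (x∈p∩q⁻ _ _ (subst (x ∈_) outside≡ (x∈p∩q⁺ (x∈p , x∉p⇒x∈∁p x∉q))))

  _≟ₛ_ : ∀ {n} → DecidableEquality (Subset n)
  _≟ₛ_ = ≡-dec Bool._≟_

  does-≟ₛ⇒≡ : ∀ {n} {g h : Subset n} → does (g ≟ₛ h) ≡ true → g ≡ h
  does-≟ₛ⇒≡ {g = g} {h} eq with g ≟ₛ h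
  ... | yes g≡h = g≡h

  -- The LYM inequality

  binomDenom : ℕ → ℕ → ℕ
  binomDenom a f = f ! * (a ∸ f) !

  binomDenom-diag : ∀ a → binomDenom a a ≡ a !
  binomDenom-diag a = trans (cong (λ d → a ! * d !) (n∸n≡0 a)) (*-identityʳ (a !))

  binomDenom-suc : ∀ {a f} → f ≤ a → binomDenom (suc a) f ≡ (suc a ∸ f) * binomDenom a f
  binomDenom-suc {a} {f} f≤a = begin
    f ! * (suc a ∸ f) !              ≡⟨ cong (λ d → f ! * d !) 1+a∸f≡1+[a∸f] ⟩
    f ! * (suc (a ∸ f) * (a ∸ f) !)  ≡⟨ x∙yz≈y∙xz (f !) (suc (a ∸ f)) _ ⟩
    suc (a ∸ f) * binomDenom a f     ≡⟨ cong (_* binomDenom a f) 1+a∸f≡1+[a∸f] ⟨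
    (suc a ∸ f) * binomDenom a f     ∎
    where
    open ≡-Reasoning
    1+a∸f≡1+[a∸f] : suc a ∸ f ≡ suc (a ∸ f)
    1+a∸f≡1+[a∸f] = +-∸-assoc 1 f≤a

  binomDenom-suc-suc : ∀ a f → binomDenom (suc a) (suc f) ≡ suc f * binomDenom a f
  binomDenom-suc-suc a f = *-assoc (suc f) (f !) ((a ∸ f) !)

  C*binomDenom≡! : ∀ {a f} → f ≤ a → (a C f) * binomDenom a f ≡ a !
  C*binomDenom≡! {a} {f} f≤a =
    trans (cong (_* binomDenom a f) (nCk≡n!/k![n-k]! f≤a))
          (m/n*n≡m {{f !* (a ∸ f) !≢0}} (k![n∸k]!∣n! f≤a))

  binomDenom-suc-∑ : ∀ {n a} {U A : Subset n} → A ⊆ U → ∣ U ∣ ≡ suc a → ∣ A ∣ ≤ a →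
    binomDenom (suc a) ∣ A ∣ ≡ ∑[ x < n ] (𝟙 (lookup U x) * (𝟙 (not (lookup A x)) * binomDenom a ∣ A ∣))
  binomDenom-suc-∑ {n} {a} {U} {A} A⊆U ∣U∣≡1+a ∣A∣≤a = begin
    binomDenom (suc a) ∣ A ∣                                  ≡⟨ binomDenom-suc ∣A∣≤a ⟩
    (suc a ∸ ∣ A ∣) * t                                       ≡⟨ cong (_* t) 1+a∸∣A∣≡∣U∖A∣ ⟩
    ∣ U ∩ ∁ A ∣ * t                                           ≡⟨ cong (_* t) (∣p∣≡∑𝟙 (U ∩ ∁ A)) ⟩
    ∑[ x < n ] 𝟙 (lookup (U ∩ ∁ A) x) * t                     ≡⟨ *-distribʳ-sum t (𝟙 ∘ lookup (U ∩ ∁ A)) ⟩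
    ∑[ x < n ] (𝟙 (lookup (U ∩ ∁ A) x) * t)                   ≡⟨ sum-cong-≗ split-indicator ⟩
    ∑[ x < n ] (𝟙 (lookup U x) * (𝟙 (not (lookup A x)) * t))  ∎
    where
    open ≡-Reasoning
    t = binomDenom a ∣ A ∣
    1+a∸∣A∣≡∣U∖A∣ : suc a ∸ ∣ A ∣ ≡ ∣ U ∩ ∁ A ∣
    1+a∸∣A∣≡∣U∖A∣ = trans (cong (_∸ ∣ A ∣) (trans (sym ∣U∣≡1+a) (sym (∣p∩∁q∣+∣q∣≡∣p∣ A⊆U))))
                          (m+n∸n≡m ∣ U ∩ ∁ A ∣ ∣ A ∣)
    split-indicator : ∀ x → 𝟙 (lookup (U ∩ ∁ A) x) * t ≡ 𝟙 (lookup U x) * (𝟙 (not (lookup A x)) * t)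
    split-indicator x = begin
      𝟙 (lookup (U ∩ ∁ A) x) * t                          ≡⟨ cong (λ b → 𝟙 b * t) (lookup-∩∁ U A x) ⟩
      𝟙 (lookup U x ∧ not (lookup A x)) * t               ≡⟨ cong (_* t) (𝟙-∧ (lookup U x) _) ⟩
      𝟙 (lookup U x) * 𝟙 (not (lookup A x)) * t           ≡⟨ *-assoc (𝟙 (lookup U x)) _ t ⟩
      𝟙 (lookup U x) * (𝟙 (not (lookup A x)) * t)         ∎

  -- Lubell's double counting: the term of Aᵢ spreads over the x ∈ U ∖ Aᵢ.
  lym-step : ∀ {n m} a (U : Subset n) → ∣ U ∣ ≡ suc a → (S : Fin m → Bool) (A : Fin m → Subset n) →
    (∀ i → S i ≡ true → A i ⊆ U) → (∀ i → S i ≡ true → ∣ A i ∣ ≤ a) →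
    (∀ x → x ∈ U → ∑[ i < m ] (𝟙 (S i ∧ not (lookup (A i) x)) * binomDenom a ∣ A i ∣) ≤ a !) →
    ∑[ i < m ] (𝟙 (S i) * binomDenom (suc a) ∣ A i ∣) ≤ suc a !
  lym-step {n} {m} a U ∣U∣≡1+a S A A⊆U ∣A∣≤a bound-avoiding = begin
    ∑[ i < m ] (𝟙 (S i) * binomDenom (suc a) ∣ A i ∣)
      ≡⟨ sum-cong-≗ spread ⟩
    ∑[ i < m ] ∑[ x < n ] (𝟙 (lookup U x) * (𝟙 (S′ x i) * binomDenom a ∣ A i ∣))
      ≡⟨ ∑-comm (λ i x → 𝟙 (lookup U x) * (𝟙 (S′ x i) * binomDenom a ∣ A i ∣)) ⟩
    ∑[ x < n ] ∑[ i < m ] (𝟙 (lookup U x) * (𝟙 (S′ x i) * binomDenom a ∣ A i ∣))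
      ≡⟨ sum-cong-≗ (λ x → *-distribˡ-sum (𝟙 (lookup U x)) (λ i → 𝟙 (S′ x i) * binomDenom a ∣ A i ∣)) ⟨
    ∑[ x < n ] (𝟙 (lookup U x) * ∑[ i < m ] (𝟙 (S′ x i) * binomDenom a ∣ A i ∣))
      ≤⟨ ∑-mono-≤ bound ⟩
    ∑[ x < n ] (𝟙 (lookup U x) * a !)
      ≡⟨ *-distribʳ-sum (a !) (𝟙 ∘ lookup U) ⟨
    ∑[ x < n ] 𝟙 (lookup U x) * a !
      ≡⟨ cong (_* a !) (trans (sym (∣p∣≡∑𝟙 U)) ∣U∣≡1+a) ⟩
    suc a * a !
      ∎
    where
    open ≤-Reasoning
    S′ : Fin n → Fin m → Bool
    S′ x i = S i ∧ not (lookup (A i) x)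
    spread : ∀ i → 𝟙 (S i) * binomDenom (suc a) ∣ A i ∣
                 ≡ ∑[ x < n ] (𝟙 (lookup U x) * (𝟙 (S′ x i) * binomDenom a ∣ A i ∣))
    spread i with S i in Sᵢ
    ... | false = sym (∑-zero λ x → *-zeroʳ (𝟙 (lookup U x)))
    ... | true  = trans (+-identityʳ _) (binomDenom-suc-∑ (A⊆U i Sᵢ) ∣U∣≡1+a (∣A∣≤a i Sᵢ))
    bound : ∀ x → 𝟙 (lookup U x) * ∑[ i < m ] (𝟙 (S′ x i) * binomDenom a ∣ A i ∣) ≤ 𝟙 (lookup U x) * a !
    bound x with lookup U x in Uₓ
    ... | false = z≤n
    ... | true  = *-monoʳ-≤ 1 (bound-avoiding x (lookup⇒[]= x U Uₓ))

  -- Lubell's ∑ 1/C(a,∣Aᵢ∣) ≤ 1 with denominators cleared, for the members of A selected by S.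
  lym : ∀ {n m} a (U : Subset n) → ∣ U ∣ ≡ a → (S : Fin m → Bool) (A : Fin m → Subset n) →
    (∀ i → S i ≡ true → A i ⊆ U) →
    (∀ i i' → S i ≡ true → S i' ≡ true → i ≢ i' → A i ⊈ A i') →
    ∑[ i < m ] (𝟙 (S i) * binomDenom a ∣ A i ∣) ≤ a !
  lym {n} {m} a U ∣U∣≡a S A A⊆U anti
    with any? {P = λ i → S i ≡ true × U ⊆ A i} (λ i → (S i Bool.≟ true) ×-dec (U ⊆? A i))
  ... | yes (i , Sᵢ , U⊆Aᵢ) = ≤-reflexive (begin
    ∑[ i' < m ] (𝟙 (S i') * binomDenom a ∣ A i' ∣)  ≡⟨ ∑-single _ i others-vanish ⟩
    𝟙 (S i) * binomDenom a ∣ A i ∣                 ≡⟨ cong₂ (λ s f → 𝟙 s * binomDenom a f) Sᵢ ∣Aᵢ∣≡a ⟩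
    binomDenom a a + 0                             ≡⟨ trans (+-identityʳ _) (binomDenom-diag a) ⟩
    a !                                            ∎)
    where
    open ≡-Reasoning
    ∣Aᵢ∣≡a : ∣ A i ∣ ≡ a
    ∣Aᵢ∣≡a = trans (cong ∣_∣ (⊆-antisym (A⊆U i Sᵢ) U⊆Aᵢ)) ∣U∣≡a
    others-vanish : ∀ i' → i' ≢ i → 𝟙 (S i') * binomDenom a ∣ A i' ∣ ≡ 0
    others-vanish i' i'≢i with S i' in Sᵢ'
    ... | false = refl
    ... | true  = ⊥-elim (anti i' i Sᵢ' Sᵢ i'≢i (⊆-trans (A⊆U i' Sᵢ') U⊆Aᵢ))
  ... | no no-full-member = lym-proper a ∣U∣≡a
    where
    ∣A∣<∣U∣ : ∀ i → S i ≡ true → ∣ A i ∣ < ∣ U ∣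
    ∣A∣<∣U∣ i Sᵢ = ⊆∧⊈⇒∣∣< (A⊆U i Sᵢ) (λ U⊆Aᵢ → no-full-member (i , Sᵢ , U⊆Aᵢ))
    lym-proper : ∀ a → ∣ U ∣ ≡ a → ∑[ i < m ] (𝟙 (S i) * binomDenom a ∣ A i ∣) ≤ a !
    lym-proper zero ∣U∣≡0 = ≤-trans (≤-reflexive (∑-zero term≡0)) z≤n
      where
      term≡0 : ∀ i → 𝟙 (S i) * binomDenom 0 ∣ A i ∣ ≡ 0
      term≡0 i with S i in Sᵢ
      ... | false = refl
      ... | true  = ⊥-elim (n≮0 (subst (_ <_) ∣U∣≡0 (∣A∣<∣U∣ i Sᵢ)))
    lym-proper (suc a) ∣U∣≡1+a = lym-step a U ∣U∣≡1+a S A A⊆U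
      (λ i Sᵢ → ≤-pred (subst (_ <_) ∣U∣≡1+a (∣A∣<∣U∣ i Sᵢ)))
      (λ x x∈U → lym a (U ∩ ∁ ⁅ x ⁆) (suc-injective (trans (∣p∩∁⁅x⁆∣+1≡∣p∣ x∈U) ∣U∣≡1+a)) _ A
         (λ i S′ᵢ → ⊆-∩∁⁅x⁆ (A⊆U i (∧-conicalˡ _ _ S′ᵢ)) (not-lookup⇒∉ (∧-conicalʳ _ _ S′ᵢ)))
         (λ i i' S′ᵢ S′ᵢ' → anti i i' (∧-conicalˡ _ _ S′ᵢ) (∧-conicalˡ _ _ S′ᵢ')))

  -- Sums over the subsets of a set

  ∑⊆ : ∀ {n} → Subset n → (Subset n → ℕ) → ℕ
  ∑⊆ []            φ = φ []
  ∑⊆ (outside ∷ v) φ = ∑⊆ v (φ ∘ (outside ∷_))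
  ∑⊆ (inside ∷ v)  φ = ∑⊆ v (φ ∘ (outside ∷_)) + ∑⊆ v (φ ∘ (inside ∷_))

  ∑⊆-cong : ∀ {n} (v : Subset n) {φ ψ : Subset n → ℕ} → (∀ g → g ⊆ v → φ g ≡ ψ g) → ∑⊆ v φ ≡ ∑⊆ v ψ
  ∑⊆-cong []            φ≡ψ = φ≡ψ [] ⊆-refl
  ∑⊆-cong (outside ∷ v) φ≡ψ = ∑⊆-cong v (λ g g⊆v → φ≡ψ _ (out⊆ g⊆v))
  ∑⊆-cong (inside ∷ v)  φ≡ψ =
    cong₂ _+_ (∑⊆-cong v (λ g g⊆v → φ≡ψ _ (out⊆ g⊆v))) (∑⊆-cong v (λ g g⊆v → φ≡ψ _ (in⊆in g⊆v)))

  ∑⊆-mono-≤ : ∀ {n} (v : Subset n) {φ ψ : Subset n → ℕ} → (∀ g → φ g ≤ ψ g) → ∑⊆ v φ ≤ ∑⊆ v ψ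
  ∑⊆-mono-≤ []            φ≤ψ = φ≤ψ []
  ∑⊆-mono-≤ (outside ∷ v) φ≤ψ = ∑⊆-mono-≤ v (φ≤ψ ∘ (outside ∷_))
  ∑⊆-mono-≤ (inside ∷ v)  φ≤ψ = +-mono-≤ (∑⊆-mono-≤ v (φ≤ψ ∘ (outside ∷_))) (∑⊆-mono-≤ v (φ≤ψ ∘ (inside ∷_)))

  ∑⊆-zero : ∀ {n} (v : Subset n) → ∑⊆ v (λ _ → 0) ≡ 0
  ∑⊆-zero []            = refl
  ∑⊆-zero (outside ∷ v) = ∑⊆-zero v
  ∑⊆-zero (inside ∷ v)  = cong₂ _+_ (∑⊆-zero v) (∑⊆-zero v)

  ∑⊆-distrib-+ : ∀ {n} (v : Subset n) (φ ψ : Subset n → ℕ) →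
    ∑⊆ v (λ g → φ g + ψ g) ≡ ∑⊆ v φ + ∑⊆ v ψ
  ∑⊆-distrib-+ []            φ ψ = refl
  ∑⊆-distrib-+ (outside ∷ v) φ ψ = ∑⊆-distrib-+ v (φ ∘ (outside ∷_)) (ψ ∘ (outside ∷_))
  ∑⊆-distrib-+ (inside ∷ v)  φ ψ =
    trans (cong₂ _+_ (∑⊆-distrib-+ v (φ ∘ (outside ∷_)) (ψ ∘ (outside ∷_)))
                     (∑⊆-distrib-+ v (φ ∘ (inside ∷_)) (ψ ∘ (inside ∷_))))
          (+-interchange (∑⊆ v (φ ∘ (outside ∷_))) _ _ _)

  *-distribˡ-∑⊆ : ∀ {n} (v : Subset n) k (φ : Subset n → ℕ) → k * ∑⊆ v φ ≡ ∑⊆ v (λ g → k * φ g)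
  *-distribˡ-∑⊆ []            k φ = refl
  *-distribˡ-∑⊆ (outside ∷ v) k φ = *-distribˡ-∑⊆ v k (φ ∘ (outside ∷_))
  *-distribˡ-∑⊆ (inside ∷ v)  k φ =
    trans (*-distribˡ-+ k _ _)
          (cong₂ _+_ (*-distribˡ-∑⊆ v k (φ ∘ (outside ∷_))) (*-distribˡ-∑⊆ v k (φ ∘ (inside ∷_))))

  ∑⊆-comm : ∀ {n m} (v : Subset n) (φ : Fin m → Subset n → ℕ) →
    ∑⊆ v (λ g → ∑[ i < m ] φ i g) ≡ ∑[ i < m ] ∑⊆ v (φ i)
  ∑⊆-comm {m = zero}  v φ = ∑⊆-zero v
  ∑⊆-comm {m = suc m} v φ =
    trans (∑⊆-distrib-+ v (φ zero) _) (cong (∑⊆ v (φ zero) +_) (∑⊆-comm v (φ ∘ suc)))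

  ∑⊆-indicator : ∀ {n} (v h : Subset n) (a : ℕ) → h ⊆ v → ∑⊆ v (λ g → 𝟙 (does (g ≟ₛ h)) * a) ≡ a
  ∑⊆-indicator []            []            a h⊆v = +-identityʳ a
  ∑⊆-indicator (outside ∷ v) (outside ∷ h) a h⊆v = ∑⊆-indicator v h a (drop-∷-⊆ h⊆v)
  ∑⊆-indicator (outside ∷ v) (inside ∷ h)  a h⊆v with () ← h⊆v here
  ∑⊆-indicator (inside ∷ v)  (outside ∷ h) a h⊆v =
    trans (cong₂ _+_ (∑⊆-indicator v h a (drop-∷-⊆ h⊆v)) (∑⊆-zero v)) (+-identityʳ a)
  ∑⊆-indicator (inside ∷ v)  (inside ∷ h)  a h⊆v = cong₂ _+_ (∑⊆-zero v) (∑⊆-indicator v h a (drop-∷-⊆ h⊆v))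

  ∑-𝟙-≟ : ∀ {r} (y : Fin r) → ∑[ k < r ] 𝟙 ⌊ y ≟ k ⌋ ≡ 1
  ∑-𝟙-≟ y = trans (∑-single (λ k → 𝟙 ⌊ y ≟ k ⌋) y off) (at y)
    where
    off : ∀ k → k ≢ y → 𝟙 ⌊ y ≟ k ⌋ ≡ 0
    off k k≢y with y ≟ k
    ... | yes y≡k = ⊥-elim (k≢y (sym y≡k))
    ... | no  _   = refl
    at : ∀ y → 𝟙 ⌊ y ≟ y ⌋ ≡ 1
    at y with y ≟ y
    ... | yes _   = refl
    ... | no  y≢y = ⊥-elim (y≢y refl)

  ∑-∣block∣ : ∀ {n r} (c : Fin n → Fin r) → ∑[ k < r ] ∣ block c k ∣ ≡ n
  ∑-∣block∣ {n} {r} c = begin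
    ∑[ k < r ] ∣ block c k ∣
      ≡⟨ sum-cong-≗ (λ k → ∣p∣≡∑𝟙 (block c k)) ⟩
    ∑[ k < r ] ∑[ x < n ] 𝟙 (lookup (block c k) x)
      ≡⟨ ∑-comm (λ k x → 𝟙 (lookup (block c k) x)) ⟩
    ∑[ x < n ] ∑[ k < r ] 𝟙 (lookup (block c k) x)
      ≡⟨ sum-cong-≗ (λ x → sum-cong-≗ (λ k → cong 𝟙 (lookup∘tabulate (λ y → ⌊ c y ≟ k ⌋) x))) ⟩
    ∑[ x < n ] ∑[ k < r ] 𝟙 ⌊ c x ≟ k ⌋
      ≡⟨ sum-cong-≗ (λ x → ∑-𝟙-≟ (c x)) ⟩
    ∑[ x < n ] 1
      ≡⟨ trans (∑-const n 1) (*-identityʳ n) ⟩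
    n
      ∎
    where open ≡-Reasoning

  ∈-block : ∀ {n r} {c : Fin n → Fin r} {k x} → x ∈ block c k → c x ≡ k
  ∈-block {c = c} {k} {x} x∈X
    with c x ≟ k | trans (sym (lookup∘tabulate (λ y → ⌊ c y ≟ k ⌋) x)) ([]=⇒lookup x∈X)
  ... | yes cx≡k | _ = cx≡k
  ... | no  _    | ()

  ∁block∩block : ∀ {n r} (c : Fin n → Fin r) {j k} → k ≢ j → ∁ (block c j) ∩ block c k ≡ block c k
  ∁block∩block c k≢j = ⊆-antisym (p∩q⊆q _ _)
    (λ x∈Xₖ → x∈p∩q⁺ (x∉p⇒x∈∁p (λ x∈Xⱼ → k≢j (trans (sym (∈-block x∈Xₖ)) (∈-block x∈Xⱼ))) , x∈Xₖ))

  -- coweight c ⊤ F = (∏ₖ ∣Xₖ∣!) / weight c F; with v in place of ⊤ the blocks are cut down to v.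
  coweight : ∀ {n r} → (Fin n → Fin r) → Subset n → Subset n → ℕ
  coweight {r = r} c v g = ∏[ k < r ] binomDenom ∣ v ∩ block c k ∣ ∣ g ∩ block c k ∣

  coweight-inside-∷ : ∀ {n r} (c : Fin (suc n) → Fin r) (v g : Subset n) → g ⊆ v →
    coweight c (inside ∷ v) (outside ∷ g) + coweight c (inside ∷ v) (inside ∷ g)
      ≡ suc (suc ∣ v ∩ block (c ∘ suc) (c zero) ∣) * coweight (c ∘ suc) v g
  coweight-inside-∷ c v g g⊆v = begin
    coweight c (inside ∷ v) (outside ∷ g) + coweight c (inside ∷ v) (inside ∷ g)
      ≡⟨ cong₂ _+_ (∏-update-≟ (λ k b → binomDenom ∣ b ∷ (v ∩ block c′ k) ∣ ∣ g ∩ block c′ k ∣) k₀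
                                {suc a ∸ f} (binomDenom-suc f≤a))
                   (∏-update-≟ (λ k b → binomDenom ∣ b ∷ (v ∩ block c′ k) ∣ ∣ b ∷ (g ∩ block c′ k) ∣) k₀
                                {suc f} (binomDenom-suc-suc a f)) ⟩
    (suc a ∸ f) * coweight c′ v g + suc f * coweight c′ v g
      ≡⟨ *-distribʳ-+ (coweight c′ v g) (suc a ∸ f) (suc f) ⟨
    (suc a ∸ f + suc f) * coweight c′ v g
      ≡⟨ cong (_* coweight c′ v g) (trans (+-suc _ f) (cong suc (m∸n+n≡m (m≤n⇒m≤1+n f≤a)))) ⟩
    suc (suc a) * coweight c′ v g
      ∎
    where
    open ≡-Reasoning
    c′ = c ∘ suc
    k₀ = c zero
    a = ∣ v ∩ block c′ k₀ ∣
    f = ∣ g ∩ block c′ k₀ ∣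
    f≤a : f ≤ a
    f≤a = p⊆q⇒∣p∣≤∣q∣ (∩-monoˡ-⊆ (block c′ k₀) g⊆v)

  -- Factor by factor this is ∑_f C(a,f) · f!(a-f)! = (a+1)!.
  ∑⊆-coweight : ∀ {n r} (c : Fin n → Fin r) (v : Subset n) →
    ∑⊆ v (coweight c v) ≡ ∏[ k < r ] (suc ∣ v ∩ block c k ∣ !)
  ∑⊆-coweight c []            = refl
  ∑⊆-coweight c (outside ∷ v) = ∑⊆-coweight (c ∘ suc) v
  ∑⊆-coweight {r = r} c (inside ∷ v) = begin
    ∑⊆ v (coweight c (inside ∷ v) ∘ (outside ∷_)) + ∑⊆ v (coweight c (inside ∷ v) ∘ (inside ∷_))
      ≡⟨ ∑⊆-distrib-+ v _ _ ⟨
    ∑⊆ v (λ g → coweight c (inside ∷ v) (outside ∷ g) + coweight c (inside ∷ v) (inside ∷ g))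
      ≡⟨ ∑⊆-cong v (coweight-inside-∷ c v) ⟩
    ∑⊆ v (λ g → suc (suc a) * coweight c′ v g)
      ≡⟨ *-distribˡ-∑⊆ v (suc (suc a)) _ ⟨
    suc (suc a) * ∑⊆ v (coweight c′ v)
      ≡⟨ cong (suc (suc a) *_) (∑⊆-coweight c′ v) ⟩
    suc (suc a) * ∏[ k < r ] (suc ∣ v ∩ block c′ k ∣ !)
      ≡⟨ ∏-update-≟ (λ k b → suc ∣ b ∷ (v ∩ block c′ k) ∣ !) (c zero) {suc (suc a)} refl ⟨
    ∏[ k < r ] (suc ∣ (inside ∷ v) ∩ block c k ∣ !)
      ∎
    where
    open ≡-Reasoning
    c′ = c ∘ suc
    a = ∣ v ∩ block c′ (c zero) ∣

  weight*coweight≡∏! : ∀ {n r} (c : Fin n → Fin r) (F : Subset n) →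
    weight c F * coweight c ⊤ F ≡ ∏[ k < r ] (∣ block c k ∣ !)
  weight*coweight≡∏! {r = r} c F = begin
    weight c F * coweight c ⊤ F
      ≡⟨ cong (_* coweight c ⊤ F) (prodℕ≡∏ binom) ⟩
    ∏ binom * ∏[ k < r ] binomDenom ∣ ⊤ ∩ X k ∣ ∣ F ∩ X k ∣
      ≡⟨ ∏-distrib-* binom (λ k → binomDenom ∣ ⊤ ∩ X k ∣ ∣ F ∩ X k ∣) ⟨
    ∏[ k < r ] (binom k * binomDenom ∣ ⊤ ∩ X k ∣ ∣ F ∩ X k ∣)
      ≡⟨ ∏-cong (λ k → cong (λ a → binom k * binomDenom ∣ a ∣ (∣ F ∩ X k ∣)) (∩-identityˡ (X k))) ⟩
    ∏[ k < r ] (binom k * binomDenom ∣ X k ∣ ∣ F ∩ X k ∣)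
      ≡⟨ ∏-cong (λ k → C*binomDenom≡! (∣p∩q∣≤∣q∣ F (X k))) ⟩
    ∏[ k < r ] (∣ X k ∣ !)
      ∎
    where
    open ≡-Reasoning
    X = block c
    binom : Fin r → ℕ
    binom k = ∣ X k ∣ C ∣ F ∩ X k ∣

  ∏∣block∣!≢0 : ∀ {n r} (c : Fin n → Fin r) → NonZero (∏[ k < r ] (∣ block c k ∣ !))
  ∏∣block∣!≢0 c = ∏-nonZero _ (λ k → ∣ block c k ∣ !≢0)

  coweight-split : ∀ {n r} (c : Fin n → Fin r) (j : Fin r) (F : Subset n) →
    coweight c ⊤ F ≡ binomDenom ∣ block c j ∣ ∣ F ∩ block c j ∣ * coweight c (∁ (block c j)) (F ∩ ∁ (block c j))
  coweight-split {n} c j F = ∏-update _ _ j {binomDenom ∣ Xⱼ ∣ (∣ F ∩ Xⱼ ∣)} off at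
    where
    Xⱼ = block c j
    off : ∀ k → k ≢ j → binomDenom (∣ ⊤ ∩ block c k ∣) (∣ F ∩ block c k ∣)
                      ≡ binomDenom (∣ ∁ Xⱼ ∩ block c k ∣) (∣ (F ∩ ∁ Xⱼ) ∩ block c k ∣)
    off k k≢j = cong₂ (λ a f → binomDenom ∣ a ∣ ∣ f ∣)
      (trans (∩-identityˡ (block c k)) (sym (∁block∩block c k≢j)))
      (trans (cong (F ∩_) (sym (∁block∩block c k≢j))) (sym (∩-assoc F (∁ Xⱼ) (block c k))))
    at : binomDenom (∣ ⊤ ∩ Xⱼ ∣) (∣ F ∩ Xⱼ ∣)
       ≡ binomDenom (∣ Xⱼ ∣) (∣ F ∩ Xⱼ ∣) * binomDenom (∣ ∁ Xⱼ ∩ Xⱼ ∣) (∣ (F ∩ ∁ Xⱼ) ∩ Xⱼ ∣)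
    at = begin
      binomDenom (∣ ⊤ ∩ Xⱼ ∣) (∣ F ∩ Xⱼ ∣)
        ≡⟨ cong (λ a → binomDenom ∣ a ∣ (∣ F ∩ Xⱼ ∣)) (∩-identityˡ Xⱼ) ⟩
      binomDenom (∣ Xⱼ ∣) (∣ F ∩ Xⱼ ∣)
        ≡⟨ *-identityʳ _ ⟨
      binomDenom (∣ Xⱼ ∣) (∣ F ∩ Xⱼ ∣) * binomDenom 0 0
        ≡⟨ cong₂ (λ a f → binomDenom (∣ Xⱼ ∣) (∣ F ∩ Xⱼ ∣) * binomDenom a f) ∣∁Xⱼ∩Xⱼ∣≡0 ∣F∩∁Xⱼ∩Xⱼ∣≡0 ⟨
      binomDenom (∣ Xⱼ ∣) (∣ F ∩ Xⱼ ∣) * binomDenom (∣ ∁ Xⱼ ∩ Xⱼ ∣) (∣ (F ∩ ∁ Xⱼ) ∩ Xⱼ ∣)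
        ∎
      where
      open ≡-Reasoning
      ∣∁Xⱼ∩Xⱼ∣≡0 : ∣ ∁ Xⱼ ∩ Xⱼ ∣ ≡ 0
      ∣∁Xⱼ∩Xⱼ∣≡0 = ∣∁p∩p∣≡0 Xⱼ
      ∣F∩∁Xⱼ∩Xⱼ∣≡0 : ∣ (F ∩ ∁ Xⱼ) ∩ Xⱼ ∣ ≡ 0
      ∣F∩∁Xⱼ∩Xⱼ∣≡0 = trans (cong ∣_∣ (trans (∩-assoc F (∁ Xⱼ) Xⱼ) (cong (F ∩_) (∩-inverseˡ Xⱼ))))
                           (trans (cong ∣_∣ (∩-zeroʳ F)) (∣⊥∣≡0 n))

  -- Group the Fᵢ by their part outside Xⱼ: within a group the parts inside Xⱼ form an antichain.
  ∑-coweight-≤-∑⊆ : ∀ {n r m} (c : Fin n → Fin r) (j : Fin r) (F : Fin m → Subset n) →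
    (∀ i i' → i ≢ i' → F i ⊈ F i') →
    ∑[ i < m ] coweight c ⊤ (F i) ≤ ∣ block c j ∣ ! * ∑⊆ (∁ (block c j)) (coweight c (∁ (block c j)))
  ∑-coweight-≤-∑⊆ {n} {r} {m} c j F anti = begin
    ∑[ i < m ] coweight c ⊤ (F i)
      ≡⟨ sum-cong-≗ (λ i → coweight-split c j (F i)) ⟩
    ∑[ i < m ] (t i * Q (o i))
      ≡⟨ sum-cong-≗ (λ i → ∑⊆-indicator V (o i) (t i * Q (o i)) (p∩q⊆q (F i) V)) ⟨
    ∑[ i < m ] ∑⊆ V (λ g → 𝟙 (does (g ≟ₛ o i)) * (t i * Q (o i)))
      ≡⟨ ∑⊆-comm V (λ i g → 𝟙 (does (g ≟ₛ o i)) * (t i * Q (o i))) ⟨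
    ∑⊆ V (λ g → ∑[ i < m ] (𝟙 (does (g ≟ₛ o i)) * (t i * Q (o i))))
      ≡⟨ ∑⊆-cong V (λ g _ → trans (sum-cong-≗ (fibre-term g))
                                   (sym (*-distribˡ-sum (Q g) (λ i → 𝟙 (does (g ≟ₛ o i)) * t i)))) ⟩
    ∑⊆ V (λ g → Q g * ∑[ i < m ] (𝟙 (does (g ≟ₛ o i)) * t i))
      ≤⟨ ∑⊆-mono-≤ V (λ g → *-monoʳ-≤ (Q g)
           (lym ∣ Xⱼ ∣ Xⱼ refl _ (λ i → F i ∩ Xⱼ) (λ i _ → p∩q⊆q (F i) Xⱼ) (fibre-antichain g))) ⟩
    ∑⊆ V (λ g → Q g * ∣ Xⱼ ∣ !)
      ≡⟨ ∑⊆-cong V (λ g _ → *-comm (Q g) _) ⟩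
    ∑⊆ V (λ g → ∣ Xⱼ ∣ ! * Q g)
      ≡⟨ *-distribˡ-∑⊆ V (∣ Xⱼ ∣ !) Q ⟨
    ∣ Xⱼ ∣ ! * ∑⊆ V Q
      ∎
    where
    open ≤-Reasoning
    Xⱼ = block c j
    V = ∁ Xⱼ
    Q = coweight c V
    o : Fin m → Subset n
    o i = F i ∩ V
    t : Fin m → ℕ
    t i = binomDenom ∣ Xⱼ ∣ ∣ F i ∩ Xⱼ ∣
    fibre-term : ∀ g i → 𝟙 (does (g ≟ₛ o i)) * (t i * Q (o i)) ≡ Q g * (𝟙 (does (g ≟ₛ o i)) * t i)
    fibre-term g i with g ≟ₛ o i
    ... | yes refl =
      trans (+-identityʳ _) (trans (*-comm (t i) (Q g)) (cong (Q g *_) (sym (+-identityʳ (t i)))))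
    ... | no  _    = sym (*-zeroʳ (Q g))
    fibre-antichain : ∀ g i i' → does (g ≟ₛ o i) ≡ true → does (g ≟ₛ o i') ≡ true → i ≢ i' →
                      F i ∩ Xⱼ ⊈ F i' ∩ Xⱼ
    fibre-antichain g i i' g≡oᵢ g≡oᵢ' i≢i' =
      anti i i' i≢i' ∘ ⊆-by-parts (trans (sym (does-≟ₛ⇒≡ {g = g} g≡oᵢ)) (does-≟ₛ⇒≡ {g = g} g≡oᵢ'))

  ∑-coweight-≤-∏ : ∀ {n r m} (c : Fin n → Fin (suc r)) (j : Fin (suc r)) (F : Fin m → Subset n) →
    (∀ i i' → i ≢ i' → F i ⊈ F i') →
    ∑[ i < m ] coweight c ⊤ (F i) ≤ ∏[ k < suc r ] (∣ block c k ∣ !) * ∏ (removeAt (λ k → suc ∣ block c k ∣) j)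
  ∑-coweight-≤-∏ {r = r} c j F anti = begin
    ∑[ i < _ ] coweight c ⊤ (F i)
      ≤⟨ ∑-coweight-≤-∑⊆ c j F anti ⟩
    a j ! * ∑⊆ (∁ Xⱼ) (coweight c (∁ Xⱼ))
      ≡⟨ cong (a j ! *_) (∑⊆-coweight c (∁ Xⱼ)) ⟩
    a j ! * ∏[ k < suc r ] (suc ∣ ∁ Xⱼ ∩ block c k ∣ !)
      ≡⟨ cong (a j ! *_) (Product.sum-remove {i = j} (λ k → suc ∣ ∁ Xⱼ ∩ block c k ∣ !)) ⟩
    a j ! * (suc ∣ ∁ Xⱼ ∩ Xⱼ ∣ ! * P′)
      ≡⟨ cong (λ x → a j ! * (suc x ! * P′)) (∣∁p∩p∣≡0 Xⱼ) ⟩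
    a j ! * (1 * P′)
      ≡⟨ cong (a j ! *_) (*-identityˡ P′) ⟩
    a j ! * P′
      ≡⟨ cong (a j ! *_) (∏-cong λ i → cong (λ x → suc ∣ x ∣ !) (∁block∩block c (punchInᵢ≢i j i))) ⟩
    a j ! * ∏[ i < r ] (suc (a (punchIn j i)) * a (punchIn j i) !)
      ≡⟨ cong (a j ! *_) (∏-distrib-* (removeAt (suc ∘ a) j) (removeAt (_! ∘ a) j)) ⟩
    a j ! * (∏ (removeAt (suc ∘ a) j) * ∏ (removeAt (_! ∘ a) j))
      ≡⟨ x∙yz≈y∙xz (a j !) (∏ (removeAt (suc ∘ a) j)) (∏ (removeAt (_! ∘ a) j)) ⟩
    ∏ (removeAt (suc ∘ a) j) * (a j ! * ∏ (removeAt (_! ∘ a) j))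
      ≡⟨ cong (∏ (removeAt (suc ∘ a) j) *_) (Product.sum-remove {i = j} (_! ∘ a)) ⟨
    ∏ (removeAt (suc ∘ a) j) * ∏[ k < suc r ] (a k !)
      ≡⟨ *-comm (∏ (removeAt (suc ∘ a) j)) _ ⟩
    ∏[ k < suc r ] (a k !) * ∏ (removeAt (suc ∘ a) j)
      ∎
    where
    open ≤-Reasoning
    Xⱼ = block c j
    a : Fin (suc r) → ℕ
    a k = ∣ block c k ∣
    P′ = ∏[ i < r ] (suc ∣ ∁ Xⱼ ∩ block c (punchIn j i) ∣ !)

  -- The AM–GM inequality

  argmax : ∀ {s} (x : Fin (suc s) → ℕ) → Σ[ j ∈ Fin (suc s) ] (∀ k → x k ≤ x j)
  argmax {zero}  x = zero , λ { zero → ≤-refl }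
  argmax {suc s} x with argmax (x ∘ suc)
  ... | j , x≤xⱼ with x zero ≤? x (suc j)
  ...   | yes x₀≤xⱼ = suc j , λ { zero → x₀≤xⱼ ; (suc k) → x≤xⱼ k }
  ...   | no  x₀≰xⱼ = zero , λ { zero → ≤-refl ; (suc k) → ≤-trans (x≤xⱼ k) (<⇒≤ (≰⇒> x₀≰xⱼ)) }

  ^-distribʳ-* : ∀ m n k → (m * n) ^ k ≡ m ^ k * n ^ k
  ^-distribʳ-* m n zero    = refl
  ^-distribʳ-* m n (suc k) = trans (cong (m * n *_) (^-distribʳ-* m n k)) (*-interchange m n (m ^ k) (n ^ k))

  n^n≢0 : ∀ n → NonZero (n ^ n)
  n^n≢0 zero    = _
  n^n≢0 (suc n) = m^n≢0 (suc n) (suc n)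

  bernoulli : ∀ k A y → A ^ k * (A + suc k * y) ≤ (A + y) ^ suc k
  bernoulli zero    A y = ≤-reflexive (identity A y)
    where
    identity : ∀ A y → 1 * (A + 1 * y) ≡ (A + y) * 1
    identity = solve-∀
  bernoulli (suc k) A y = begin
    A ^ suc k * (A + suc (suc k) * y)
      ≤⟨ m≤m+n _ (suc k * (A ^ k * (y * y))) ⟩
    A ^ suc k * (A + suc (suc k) * y) + suc k * (A ^ k * (y * y))
      ≡⟨ identity A y (A ^ k) k ⟨
    (A + y) * (A ^ k * (A + suc k * y))
      ≤⟨ *-monoʳ-≤ (A + y) (bernoulli k A y) ⟩
    (A + y) ^ suc (suc k)
      ∎
    where
    open ≤-Reasoning
    identity : ∀ A y Aᵏ k → (A + y) * (Aᵏ * (A + suc k * y))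
                          ≡ A * Aᵏ * (A + suc (suc k) * y) + suc k * (Aᵏ * (y * y))
    identity = solve-∀

  -- AM–GM for s copies of T/s and one x. When T ≤ s x it is Bernoulli's inequality
  -- for A = (s+1)T and y = s x - T.
  amgm-step : ∀ s T x → T ≤ s * x → suc s ^ suc s * (x * T ^ s) ≤ s ^ s * (T + x) ^ suc s
  amgm-step zero    T x _   = subst₂ _≤_ (sym (identityˡ x)) (sym (identityʳ T x)) (m≤n+m x T)
    where
    identityˡ : ∀ x → 1 * (x * 1) ≡ x
    identityˡ = solve-∀
    identityʳ : ∀ T x → 1 * ((T + x) * 1) ≡ T + x
    identityʳ = solve-∀
  amgm-step s@(suc _) T x T≤sx = *-cancelˡ-≤ s (begin
    s * (suc s ^ suc s * (x * T ^ s))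
      ≡⟨ rearrange s (suc s ^ s) (T ^ s) x ⟩
    suc s ^ s * T ^ s * (suc s * (s * x))
      ≡⟨ cong₂ _*_ (^-distribʳ-* (suc s) T s) (cong (suc s *_) T+y≡sx) ⟨
    (suc s * T) ^ s * (suc s * (T + y))
      ≡⟨ cong ((suc s * T) ^ s *_) (*-distribˡ-+ (suc s) T y) ⟩
    (suc s * T) ^ s * (suc s * T + suc s * y)
      ≤⟨ bernoulli s (suc s * T) y ⟩
    (suc s * T + y) ^ suc s
      ≡⟨ cong (_^ suc s) 1+s*T+y≡s*[T+x] ⟩
    (s * (T + x)) ^ suc s
      ≡⟨ ^-distribʳ-* s (T + x) (suc s) ⟩
    s * s ^ s * (T + x) ^ suc s
      ≡⟨ *-assoc s (s ^ s) _ ⟩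
    s * (s ^ s * (T + x) ^ suc s)
      ∎)
    where
    open ≤-Reasoning
    y = s * x ∸ T
    T+y≡sx : T + y ≡ s * x
    T+y≡sx = m+[n∸m]≡n T≤sx
    1+s*T+y≡s*[T+x] : suc s * T + y ≡ s * (T + x)
    1+s*T+y≡s*[T+x] = begin-equality
      T + s * T + y    ≡⟨ cong (_+ y) (+-comm T (s * T)) ⟩
      s * T + T + y    ≡⟨ +-assoc (s * T) T y ⟩
      s * T + (T + y)  ≡⟨ cong (s * T +_) T+y≡sx ⟩
      s * T + s * x    ≡⟨ *-distribˡ-+ s T x ⟨
      s * (T + x)      ∎
    rearrange : ∀ s P U x → s * (suc s * P * (x * U)) ≡ P * U * (suc s * (s * x))
    rearrange = solve-∀

  -- Removing a largest entry secures the hypothesis of amgm-step.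
  amgm : ∀ s (x : Fin s → ℕ) → s ^ s * ∏ x ≤ sum x ^ s
  amgm zero    x = ≤-refl
  amgm (suc s) x with argmax x
  ... | m , x≤xₘ = *-cancelˡ-≤ (s ^ s) {{n^n≢0 s}} (begin
    s ^ s * (suc s ^ suc s * ∏ x)
      ≡⟨ cong (λ p → s ^ s * (suc s ^ suc s * p)) (Product.sum-remove {i = m} x) ⟩
    s ^ s * (suc s ^ suc s * (x m * P))
      ≡⟨ trans (x∙yz≈y∙xz (s ^ s) (suc s ^ suc s) (x m * P))
               (cong (suc s ^ suc s *_) (x∙yz≈y∙xz (s ^ s) (x m) P)) ⟩
    suc s ^ suc s * (x m * (s ^ s * P))
      ≤⟨ *-monoʳ-≤ (suc s ^ suc s) (*-monoʳ-≤ (x m) (amgm s (removeAt x m))) ⟩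
    suc s ^ suc s * (x m * T ^ s)
      ≤⟨ amgm-step s T (x m) T≤s*xₘ ⟩
    s ^ s * (T + x m) ^ suc s
      ≡⟨ cong (λ t → s ^ s * t ^ suc s) (trans (+-comm T (x m)) (sym (sum-remove {i = m} x))) ⟩
    s ^ s * sum x ^ suc s
      ∎)
    where
    open ≤-Reasoning
    P = ∏ (removeAt x m)
    T = sum (removeAt x m)
    T≤s*xₘ : T ≤ s * x m
    T≤s*xₘ = ≤-trans (∑-mono-≤ (λ i → x≤xₘ (punchIn m i))) (≤-reflexive (∑-const s (x m)))

  -- AM–GM for the s numbers aₖ + 1 (k ≠ j), whose sum is at most s(∑a + s + 1)/(s + 1) as aⱼ is maximal.
  ∏-removeAt-suc-≤ : ∀ {s} (a : Fin (suc s) → ℕ) (j : Fin (suc s)) → (∀ k → a k ≤ a j) →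
    suc s ^ s * ∏ (removeAt (suc ∘ a) j) ≤ (sum a + suc s) ^ s
  ∏-removeAt-suc-≤ {s} a j a≤aⱼ = *-cancelˡ-≤ (s ^ s) {{n^n≢0 s}} (begin
    s ^ s * (suc s ^ s * ∏ (removeAt (suc ∘ a) j))
      ≡⟨ x∙yz≈y∙xz (s ^ s) (suc s ^ s) _ ⟩
    suc s ^ s * (s ^ s * ∏ (removeAt (suc ∘ a) j))
      ≤⟨ *-monoʳ-≤ (suc s ^ s) (amgm s (removeAt (suc ∘ a) j)) ⟩
    suc s ^ s * sum (removeAt (suc ∘ a) j) ^ s
      ≡⟨ cong (λ t → suc s ^ s * t ^ s) ∑suc≡s+B ⟩
    suc s ^ s * (s + B) ^ s
      ≡⟨ ^-distribʳ-* (suc s) (s + B) s ⟨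
    (suc s * (s + B)) ^ s
      ≤⟨ ^-monoˡ-≤ s linear ⟩
    (s * (sum a + suc s)) ^ s
      ≡⟨ ^-distribʳ-* s (sum a + suc s) s ⟩
    s ^ s * (sum a + suc s) ^ s
      ∎)
    where
    open ≤-Reasoning
    B = sum (removeAt a j)
    ∑suc≡s+B : sum (removeAt (suc ∘ a) j) ≡ s + B
    ∑suc≡s+B = trans (∑-distrib-+ (λ _ → 1) (removeAt a j)) (cong (_+ B) (trans (∑-const s 1) (*-identityʳ s)))
    B≤s*aⱼ : B ≤ s * a j
    B≤s*aⱼ = ≤-trans (∑-mono-≤ (λ i → a≤aⱼ (punchIn j i))) (≤-reflexive (∑-const s (a j)))
    linear : suc s * (s + B) ≤ s * (sum a + suc s)
    linear = begin
      suc s * (s + B)              ≡⟨ expand s B ⟩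
      s * (B + suc s) + B          ≤⟨ +-monoʳ-≤ (s * (B + suc s)) B≤s*aⱼ ⟩
      s * (B + suc s) + s * a j    ≡⟨ collect s B (a j) ⟩
      s * (a j + B + suc s)        ≡⟨ cong (λ t → s * (t + suc s)) (sum-remove {i = j} a) ⟨
      s * (sum a + suc s)          ∎
      where
      expand : ∀ s B → suc s * (s + B) ≡ s * (B + suc s) + B
      expand = solve-∀
      collect : ∀ s B aⱼ → s * (B + suc s) + s * aⱼ ≡ s * (aⱼ + B + suc s)
      collect = solve-∀

  ∏-removeAt-suc∣block∣-≤ : ∀ {n s} (c : Fin n → Fin (suc s)) (j : Fin (suc s)) →
    (∀ k → ∣ block c k ∣ ≤ ∣ block c j ∣) →
    suc s ^ s * ∏ (removeAt (λ k → suc ∣ block c k ∣) j) ≤ (n + suc s) ^ s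
  ∏-removeAt-suc∣block∣-≤ {s = s} c j j-max =
    subst (λ t → suc s ^ s * ∏ (removeAt (λ k → suc ∣ block c k ∣) j) ≤ (t + suc s) ^ s) (∑-∣block∣ c)
          (∏-removeAt-suc-≤ (λ k → ∣ block c k ∣) j j-max)

  -- frac a d is a / (1 + d), the denominator convention of mkℚᵘ.
  frac : ℕ → ℕ → ℚᵘ
  frac a d = mkℚᵘ (ℤ.+ a) d

  frac-≤ : ∀ {a d b e} → a * suc e ≤ b * suc d → frac a d ≤ᵘ frac b e
  frac-≤ {a} {d} {b} {e} ad≤bc = *≤* (subst₂ ℤ._≤_ (pos-* a (suc e)) (pos-* b (suc d)) (ℤ.+≤+ ad≤bc))

  frac-≃ : ∀ {a d b e} → a * suc e ≡ b * suc d → frac a d ≃ᵘ frac b e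
  frac-≃ {a} {d} {b} {e} ad≡bc = *≡* (trans (sym (pos-* a (suc e))) (trans (cong ℤ.+_ ad≡bc) (pos-* b (suc d))))

  frac-+ : ∀ a b d → frac a d +ᵘ frac b d ≃ᵘ frac (a + b) d
  frac-+ a b d = ≃-trans (≃-reflexive (cong (λ z → mkℚᵘ z (d + d * suc d)) numerator)) (frac-≃ (identity a b d))
    where
    numerator : ℤ.+ a ℤ.* ℤ.+ suc d ℤ.+ ℤ.+ b ℤ.* ℤ.+ suc d ≡ ℤ.+ (a * suc d + b * suc d)
    numerator = sym (trans (pos-+ (a * suc d) (b * suc d)) (cong₂ ℤ._+_ (pos-* a (suc d)) (pos-* b (suc d))))
    identity : ∀ a b d → (a * suc d + b * suc d) * suc d ≡ (a + b) * suc (d + d * suc d)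
    identity = solve-∀

  frac-* : ∀ a d b e → frac a d *ᵘ frac b e ≡ frac (a * b) (e + d * suc e)
  frac-* a d b e = cong (λ z → mkℚᵘ z (e + d * suc e)) (sym (pos-* a b))

  toℚᵘ-sumℚ : ∀ {m} (q : Fin m → ℚ) (P : Fin m → ℕ) d →
    (∀ i → toℚᵘ (q i) ≃ᵘ frac (P i) d) → toℚᵘ (sumℚ q) ≃ᵘ frac (sum P) d
  toℚᵘ-sumℚ {zero}  q P d q≃P = frac-≃ refl
  toℚᵘ-sumℚ {suc m} q P d q≃P = ≃-trans (toℚᵘ-homo-+ (q zero) (sumℚ (q ∘ suc)))
    (≃-trans (+ᵘ-cong (q≃P zero) (toℚᵘ-sumℚ (q ∘ suc) (P ∘ suc) d (q≃P ∘ suc))) (frac-+ (P zero) _ d))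

  toℚᵘ-^ℚ : ∀ q a d k → toℚᵘ q ≃ᵘ frac a d → toℚᵘ (q ^ℚ k) ≃ᵘ frac (a ^ k) (pred (suc d ^ k))
  toℚᵘ-^ℚ q a d zero    q≃a/d = ≃-refl
  toℚᵘ-^ℚ q a d (suc k) q≃a/d = ≃-trans (toℚᵘ-homo-* q (q ^ℚ k))
    (≃-trans (*ᵘ-cong q≃a/d (toℚᵘ-^ℚ q a d k q≃a/d))
    (≃-trans (≃-reflexive (frac-* a d (a ^ k) e)) (frac-≃ (cong (a ^ suc k *_) denominator))))
    where
    e = pred (suc d ^ k)
    denominator : suc (pred (suc d ^ suc k)) ≡ suc (e + d * suc e)
    denominator = begin
      suc (pred (suc d ^ suc k))  ≡⟨ suc-pred (suc d ^ suc k) {{m^n≢0 (suc d) (suc k)}} ⟩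
      suc d * suc d ^ k           ≡⟨ cong (suc d *_) (suc-pred (suc d ^ k) {{m^n≢0 (suc d) k}}) ⟨
      suc d * suc e               ∎
      where open ≡-Reasoning

  toℚᵘ-recipℕ : ∀ w P N → w * P ≡ suc N → toℚᵘ (recipℕ w) ≃ᵘ frac P N
  toℚᵘ-recipℕ (suc w) P N wP≡1+N =
    ≃-trans (toℚᵘ-fromℚᵘ (mkℚᵘ (ℤ.+ 1) w))
            (frac-≃ (trans (+-identityʳ (suc N)) (trans (sym wP≡1+N) (*-comm (suc w) P))))

  toℚᵘ-1+n/r : ∀ n s → toℚᵘ (1ℚ ℚ.+ ℤ.+ n ℚ./ suc s) ≃ᵘ frac (n + suc s) s
  toℚᵘ-1+n/r n s = ≃-trans (toℚᵘ-homo-+ 1ℚ (ℤ.+ n ℚ./ suc s))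
    (≃-trans (+ᵘ-cong (≃-refl {toℚᵘ 1ℚ}) (toℚᵘ-fromℚᵘ (mkℚᵘ (ℤ.+ n) s)))
    (≃-trans (≃-reflexive (cong (λ z → mkℚᵘ z (s + 0)) numerator)) (frac-≃ (identity n s))))
    where
    numerator : ℤ.+ 1 ℤ.* ℤ.+ suc s ℤ.+ ℤ.+ n ℤ.* ℤ.+ 1 ≡ ℤ.+ (1 * suc s + n * 1)
    numerator = sym (trans (pos-+ (1 * suc s) (n * 1)) (cong₂ ℤ._+_ (pos-* 1 (suc s)) (pos-* n 1)))
    identity : ∀ n s → (1 * suc s + n * 1) * suc s ≡ (n + suc s) * suc (s + 0)
    identity = solve-∀

  sumℚ-recipℕ-≤ : ∀ {m n s} (w P : Fin m → ℕ) (N R : ℕ) .{{_ : NonZero N}} →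
    (∀ i → w i * P i ≡ N) → sum P ≤ N * R → suc s ^ s * R ≤ (n + suc s) ^ s →
    sumℚ (λ i → recipℕ (w i)) ℚ.≤ (1ℚ ℚ.+ ℤ.+ n ℚ./ suc s) ^ℚ s
  sumℚ-recipℕ-≤ {n = n} {s} w P N R wP≡N ∑P≤NR rˢR≤[n+r]ˢ =
    toℚᵘ-cancel-≤ (≤-respʳ-≃ (≃-sym rhs) (≤-respˡ-≃ (≃-sym lhs) (frac-≤ cross)))
    where
    N′ = pred N
    D = pred (suc s ^ s)
    lhs : toℚᵘ (sumℚ (λ i → recipℕ (w i))) ≃ᵘ frac (sum P) N′
    lhs = toℚᵘ-sumℚ _ P N′ (λ i → toℚᵘ-recipℕ (w i) (P i) N′ (trans (wP≡N i) (sym (suc-pred N))))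
    rhs : toℚᵘ ((1ℚ ℚ.+ ℤ.+ n ℚ./ suc s) ^ℚ s) ≃ᵘ frac ((n + suc s) ^ s) D
    rhs = toℚᵘ-^ℚ _ (n + suc s) s s (toℚᵘ-1+n/r n s)
    cross : sum P * suc D ≤ (n + suc s) ^ s * suc N′
    cross = begin
      sum P * suc D               ≡⟨ cong (sum P *_) (suc-pred (suc s ^ s) {{m^n≢0 (suc s) s}}) ⟩
      sum P * suc s ^ s           ≤⟨ *-monoˡ-≤ (suc s ^ s) ∑P≤NR ⟩
      N * R * suc s ^ s           ≡⟨ xy∙z≈x∙zy N R (suc s ^ s) ⟩
      N * (suc s ^ s * R)         ≤⟨ *-monoʳ-≤ N rˢR≤[n+r]ˢ ⟩
      N * (n + suc s) ^ s         ≡⟨ *-comm N _ ⟩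
      (n + suc s) ^ s * N         ≡⟨ cong ((n + suc s) ^ s *_) (suc-pred N) ⟨
      (n + suc s) ^ s * suc N′    ∎
      where open ≤-Reasoning

open import Data.Fin.Subset using (⊤; ∣_∣)
open import Data.Integer using (+_)
open import Data.Nat using (ℕ; NonZero; _∸_; suc)
open import Data.Product using (_,_)
open import Data.Rational using (ℚ; 1ℚ; _+_; _/_; _≤_)
open import Relation.Binary.PropositionalEquality using (_≢_)
open import Relation.Nullary using (¬_)

corollary3p4 : (n r : ℕ) .{{_ : NonZero r}} (c : Fin n → Fin r)
    (m : ℕ) (F : Fin m → Subset n)
    → (∀ i j → i ≢ j → ¬ (F i ⊆ F j))
    → sumℚ (λ i → recipℕ (weight c (F i))) ≤ (1ℚ + (+ n / r)) ^ℚ (r ∸ 1)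
corollary3p4 n (suc s) c m F antichain with argmax (λ k → ∣ block c k ∣)
... | j , j-max =
  sumℚ-recipℕ-≤ {n = n} {s} (λ i → weight c (F i)) (λ i → coweight c ⊤ (F i)) _ _ {{∏∣block∣!≢0 c}}
    (λ i → weight*coweight≡∏! c (F i))
    (∑-coweight-≤-∏ c j F antichain)
    (∏-removeAt-suc∣block∣-≤ c j j-max)
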